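{- Let $D$ be a sink-free digraph. If $D$ has a quasi-kernel $Q$ such that the induced subdigraph $D[N^{ -- }(Q)]$ has a kernel, then $D$ has a quasi-kernel of size at most $|V(D)|/2$.
   Context: A kernel of a digraph $D$ is an independent set $K\subseteq V(D)$ such that every vertex of $V(D)\setminus K$ has an arc to some vertex of $K$. A quasi-kernel is an independent set $Q\subseteq V(D)$ such that for every vertex $v\in V(D)\setminus Q$ there is a directed path with one or two arcs from $v$ to some vertex of $Q$. $D$ is sink-free if every vertex has an out-neighbour. For $S\subseteq V(D)$, $N^-(S)=\{x\in V(D)\setminus S:\exists y\in S,\ xy\in A(D)\}$, $N^-[S]=N^-(S)\cup S$, and $N^{ -- }(S)=N^-(N^-[S])$ (the set of vertices outside $N^-[S]$ having an arc into $N^-[S]$). The empty digraph is considered to have the empty set as a kernel. -}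

module Defs where

open import Data.Nat using (ℕ)
open import Data.Fin using (Fin)
open import Data.Fin.Subset using (Subset; _∈_; _∉_; _⊆_)
open import Data.Product using (Σ; ∃; ∃-syntax; _×_; _,_)
open import Data.Sum using (_⊎_)
open import Relation.Nullary using (¬_; Dec)
open import Relation.Binary.PropositionalEquality using (_≡_)
open import Level using (0ℓ)

record Digraph : Set₁ where
  field
    n     : ℕ
    Arc   : Fin n → Fin n → Set
    Arc?  : ∀ x y → Dec (Arc x y)
    loopless : ∀ x → ¬ Arc x x

module _ (D : Digraph) where
  open Digraph D

  SinkFree : Set
  SinkFree = ∀ v → ∃[ w ] Arc v w

  Independent : Subset n → Set
  Independent S = ∀ x y → x ∈ S → y ∈ S → ¬ Arc x y

  -- Kernel of the induced subdigraph D[S]: K ⊆ S independent, and every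
  -- vertex of S ∖ K has an arc to some vertex of K.
  KernelOf : Subset n → Subset n → Set
  KernelOf S K = K ⊆ S × Independent K
               × (∀ v → v ∈ S → v ∉ K → ∃[ w ] (w ∈ K × Arc v w))

  Kernel : Subset n → Set
  Kernel K = Independent K × (∀ v → v ∉ K → ∃[ w ] (w ∈ K × Arc v w))

  QuasiKernel : Subset n → Set
  QuasiKernel Q = Independent Q ×
    (∀ v → v ∉ Q → ∃[ w ] (w ∈ Q × (Arc v w ⊎ ∃[ u ] (Arc v u × Arc u w))))

  -- N⁻[S] = S ∪ N⁻(S): vertices in S or having an arc into S
  InClosedIn : Subset n → Fin n → Set
  InClosedIn S x = x ∈ S ⊎ ∃[ y ] (y ∈ S × Arc x y)

  -- N⁻⁻(S) = N⁻(N⁻[S]): vertices outside N⁻[S] with an arc into N⁻[S]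
  InSecond : Subset n → Fin n → Set
  InSecond S x = ¬ InClosedIn S x × ∃[ y ] (InClosedIn S y × Arc x y)

  IsN⁻⁻ : Subset n → Subset n → Set
  IsN⁻⁻ S R = ∀ x → (x ∈ R → InSecond S x) × (InSecond S x → x ∈ R)

{-# OPTIONS --safe #-}
-- Let A = N⁻(Q), let ψ send each vertex of A to an out-neighbour in Q, put Z = ψ(A) and let
-- B be the vertices of Q ∖ Z with no arc into R = N⁻⁻(Q). Then Y₁ = Q ∖ B and
-- Y₂ = K ∪ (Z ∖ N⁻(K)) ∪ B are both quasi-kernels: a vertex of B reaches Y₁ through an
-- out-neighbour w ∈ A and ψ w ∈ Z, while a vertex of Q outside Y₂ has an arc into R, which K
-- absorbs. Now Y₁ ∪ Y₂ ⊆ Q ∪ K and Y₁ ∩ Y₂ ⊆ Z, and A is disjoint from Q ∪ K, so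
-- |Y₁| + |Y₂| ≤ |Q ∪ K| + |Z| ≤ |Q ∪ K| + |A| ≤ |V(D)|; the smaller of the two does the job.
module Submission where

open import Defs
open import Data.Nat using (ℕ; suc; _*_; _+_; _≤_; s≤s; _≤?_)
open import Data.Nat.Properties
  using (+-suc; +-comm; +-identityʳ; +-mono-≤; +-monoʳ-≤; ≤-trans; ≤-reflexive; m≤m+n; ≰⇒≥; module ≤-Reasoning)
open import Data.Fin using (Fin; zero; suc)
open import Data.Fin.Properties using (any?; _≟_)
open import Data.Fin.Subset
  using (Subset; inside; outside; _∈_; _∉_; _⊆_; _∪_; _∩_; ⊥; ⁅_⁆; ∣_∣; Empty)
open import Data.Fin.Subset.Properties
  using (_∈?_; p⊆q⇒∣p∣≤∣q∣; ∣p∣≤n; ∣⊥∣≡0; ∣⁅x⁆∣≡1; x∈⁅x⁆; Empty-unique;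
         p⊆p∪q; q⊆p∪q; x∈p∪q⁺; x∈p∪q⁻; x∈p∩q⁻)
open import Data.Vec using ([]; _∷_; tabulate; there)
open import Data.Vec.Properties using (lookup∘tabulate; []=⇒lookup; lookup⇒[]=)
open import Data.Product using (∃-syntax; _×_; _,_; proj₁; proj₂)
open import Data.Sum using (_⊎_; inj₁; inj₂)
open import Data.Empty using (⊥-elim)
open import Function using (_∘_; case_of_)
open import Level using (Level)
open import Relation.Nullary using (¬_; yes; no; does)
open import Relation.Nullary.Decidable using (dec-true; _×-dec_; ¬?)
open import Relation.Unary using (Pred; Decidable)
open import Relation.Binary.PropositionalEquality using (_≡_; refl; sym; trans; cong; module ≡-Reasoning)

module SubsetCounting where

  private
    variable
      ℓ : Level
      k m n : ℕ

  select : {P : Pred (Fin n) ℓ} → Decidable P → Subset n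
  select P? = tabulate (does ∘ P?)

  module _ {P : Pred (Fin n) ℓ} (P? : Decidable P) where

    ∈-select⁺ : ∀ {i} → P i → i ∈ select P?
    ∈-select⁺ {i} p = lookup⇒[]= i (select P?) (trans (lookup∘tabulate _ i) (dec-true (P? i) p))

    ∈-select⁻ : ∀ {i} → i ∈ select P? → P i
    ∈-select⁻ {i} i∈ with P? i | trans (sym (lookup∘tabulate (does ∘ P?) i)) ([]=⇒lookup i∈)
    ... | yes p | _ = p
    ... | no _  | ()

  ∣p∪q∣+∣p∩q∣≡∣p∣+∣q∣ : ∀ (p q : Subset n) → ∣ p ∪ q ∣ + ∣ p ∩ q ∣ ≡ ∣ p ∣ + ∣ q ∣
  ∣p∪q∣+∣p∩q∣≡∣p∣+∣q∣ []            []            = refl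
  ∣p∪q∣+∣p∩q∣≡∣p∣+∣q∣ (outside ∷ p) (outside ∷ q) = ∣p∪q∣+∣p∩q∣≡∣p∣+∣q∣ p q
  ∣p∪q∣+∣p∩q∣≡∣p∣+∣q∣ (outside ∷ p) (inside  ∷ q) =
    trans (cong suc (∣p∪q∣+∣p∩q∣≡∣p∣+∣q∣ p q)) (sym (+-suc ∣ p ∣ ∣ q ∣))
  ∣p∪q∣+∣p∩q∣≡∣p∣+∣q∣ (inside  ∷ p) (outside ∷ q) = cong suc (∣p∪q∣+∣p∩q∣≡∣p∣+∣q∣ p q)
  ∣p∪q∣+∣p∩q∣≡∣p∣+∣q∣ (inside  ∷ p) (inside  ∷ q) = cong suc (begin
    ∣ p ∪ q ∣ + suc ∣ p ∩ q ∣  ≡⟨ +-suc ∣ p ∪ q ∣ ∣ p ∩ q ∣ ⟩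
    suc (∣ p ∪ q ∣ + ∣ p ∩ q ∣) ≡⟨ cong suc (∣p∪q∣+∣p∩q∣≡∣p∣+∣q∣ p q) ⟩
    suc (∣ p ∣ + ∣ q ∣)         ≡⟨ +-suc ∣ p ∣ ∣ q ∣ ⟨
    ∣ p ∣ + suc ∣ q ∣           ∎)
    where open ≡-Reasoning

  ∣p∪q∣≤∣p∣+∣q∣ : ∀ (p q : Subset n) → ∣ p ∪ q ∣ ≤ ∣ p ∣ + ∣ q ∣
  ∣p∪q∣≤∣p∣+∣q∣ p q = ≤-trans (m≤m+n ∣ p ∪ q ∣ ∣ p ∩ q ∣) (≤-reflexive (∣p∪q∣+∣p∩q∣≡∣p∣+∣q∣ p q))

  Empty[p∩q]⇒∣p∣+∣q∣≤n : ∀ (p q : Subset n) → Empty (p ∩ q) → ∣ p ∣ + ∣ q ∣ ≤ n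
  Empty[p∩q]⇒∣p∣+∣q∣≤n {n} p q disjoint = begin
    ∣ p ∣ + ∣ q ∣              ≡⟨ ∣p∪q∣+∣p∩q∣≡∣p∣+∣q∣ p q ⟨
    ∣ p ∪ q ∣ + ∣ p ∩ q ∣      ≡⟨ cong (λ s → ∣ p ∪ q ∣ + ∣ s ∣) (Empty-unique disjoint) ⟩
    ∣ p ∪ q ∣ + ∣ ⊥ {n} ∣      ≡⟨ cong (∣ p ∪ q ∣ +_) (∣⊥∣≡0 n) ⟩
    ∣ p ∪ q ∣ + 0              ≡⟨ +-identityʳ ∣ p ∪ q ∣ ⟩
    ∣ p ∪ q ∣                  ≤⟨ ∣p∣≤n (p ∪ q) ⟩
    n                          ∎
    where open ≤-Reasoning

  module _ (f : Fin k → Fin m) (p : Subset k) where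

    preimage? : Decidable (λ y → ∃[ x ] (x ∈ p × f x ≡ y))
    preimage? y = any? (λ x → x ∈? p ×-dec f x ≟ y)

    image : Subset m
    image = select preimage?

    ∈-image⁺ : ∀ {x} → x ∈ p → f x ∈ image
    ∈-image⁺ {x} x∈p = ∈-select⁺ preimage? (x , x∈p , refl)

    ∈-image⁻ : ∀ {y} → y ∈ image → ∃[ x ] (x ∈ p × f x ≡ y)
    ∈-image⁻ = ∈-select⁻ preimage?

  ∣image∣≤∣p∣ : ∀ (f : Fin k → Fin m) (p : Subset k) → ∣ image f p ∣ ≤ ∣ p ∣
  ∣image∣≤∣p∣ {m = m} f [] = ≤-reflexive (trans (cong ∣_∣ image≡⊥) (∣⊥∣≡0 m))
    where
    image≡⊥ : image f [] ≡ ⊥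
    image≡⊥ = Empty-unique λ (y , y∈) → case ∈-image⁻ f [] y∈ of λ { (() , _) }
  ∣image∣≤∣p∣ f (outside ∷ p) = ≤-trans (p⊆q⇒∣p∣≤∣q∣ image⊆) (∣image∣≤∣p∣ (f ∘ suc) p)
    where
    image⊆ : image f (outside ∷ p) ⊆ image (f ∘ suc) p
    image⊆ y∈ with ∈-image⁻ f (outside ∷ p) y∈
    ... | suc x , there x∈p , refl = ∈-image⁺ (f ∘ suc) p x∈p
  ∣image∣≤∣p∣ f (inside ∷ p) = begin
    ∣ image f (inside ∷ p) ∣                   ≤⟨ p⊆q⇒∣p∣≤∣q∣ image⊆ ⟩
    ∣ ⁅ f zero ⁆ ∪ image (f ∘ suc) p ∣         ≤⟨ ∣p∪q∣≤∣p∣+∣q∣ ⁅ f zero ⁆ (image (f ∘ suc) p) ⟩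
    ∣ ⁅ f zero ⁆ ∣ + ∣ image (f ∘ suc) p ∣     ≡⟨ cong (_+ ∣ image (f ∘ suc) p ∣) (∣⁅x⁆∣≡1 (f zero)) ⟩
    suc ∣ image (f ∘ suc) p ∣                  ≤⟨ s≤s (∣image∣≤∣p∣ (f ∘ suc) p) ⟩
    suc ∣ p ∣                                  ∎
    where
    open ≤-Reasoning
    image⊆ : image f (inside ∷ p) ⊆ ⁅ f zero ⁆ ∪ image (f ∘ suc) p
    image⊆ y∈ with ∈-image⁻ f (inside ∷ p) y∈
    ... | zero  , _         , refl = p⊆p∪q (image (f ∘ suc) p) (x∈⁅x⁆ (f zero))
    ... | suc x , there x∈p , refl = q⊆p∪q ⁅ f zero ⁆ _ (∈-image⁺ (f ∘ suc) p x∈p)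

  m≤n⇒2*m≤m+n : ∀ {m n} → m ≤ n → 2 * m ≤ m + n
  m≤n⇒2*m≤m+n {m} m≤n = +-monoʳ-≤ m (≤-trans (≤-reflexive (+-identityʳ m)) m≤n)

  smaller-of-two : ∀ {P : Subset n → Set ℓ} {X Y : Subset n} → P X → P Y →
                   ∣ X ∣ + ∣ Y ∣ ≤ m → ∃[ S ] (P S × 2 * ∣ S ∣ ≤ m)
  smaller-of-two {X = X} {Y} PX PY X+Y≤m with ∣ X ∣ ≤? ∣ Y ∣
  ... | yes X≤Y = X , PX , ≤-trans (m≤n⇒2*m≤m+n X≤Y) X+Y≤m
  ... | no  X≰Y = Y , PY , ≤-trans (m≤n⇒2*m≤m+n (≰⇒≥ X≰Y))
                                   (≤-trans (≤-reflexive (+-comm ∣ Y ∣ ∣ X ∣)) X+Y≤m)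

open SubsetCounting

module _ (D : Digraph) where
  open Digraph D

  ArcInto : Subset n → Fin n → Set
  ArcInto S v = ∃[ w ] (w ∈ S × Arc v w)

  arcInto? : ∀ S → Decidable (ArcInto S)
  arcInto? S v = any? (λ w → w ∈? S ×-dec Arc? v w)

  ReachesIn≤2 : Subset n → Fin n → Set
  ReachesIn≤2 S v = ∃[ w ] (w ∈ S × (Arc v w ⊎ ∃[ u ] (Arc v u × Arc u w)))

  module _ {Q R : Subset n} (R-spec : IsN⁻⁻ D Q R) where

    ∈N⁻⁻⇒∉Q : ∀ {v} → v ∈ R → v ∉ Q
    ∈N⁻⁻⇒∉Q v∈R v∈Q = proj₁ (proj₁ (R-spec _) v∈R) (inj₁ v∈Q)

    ∈N⁻⁻⇒¬ArcInto : ∀ {v} → v ∈ R → ¬ ArcInto Q v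
    ∈N⁻⁻⇒¬ArcInto v∈R v→Q = proj₁ (proj₁ (R-spec _) v∈R) (inj₂ v→Q)

    ∉N⁻⁻⇒ArcInto : QuasiKernel D Q → ∀ {v} → v ∉ Q → v ∉ R → ArcInto Q v
    ∉N⁻⁻⇒ArcInto (_ , Q-reach) {v} v∉Q v∉R with arcInto? Q v | Q-reach v v∉Q
    ... | yes v→Q | _                            = v→Q
    ... | no ¬v→Q | w , w∈Q , inj₁ v→w            = ⊥-elim (¬v→Q (w , w∈Q , v→w))
    ... | no ¬v→Q | w , w∈Q , inj₂ (u , v→u , u→w) =
      ⊥-elim (v∉R (proj₂ (R-spec v) (v∉N⁻[Q] , u , inj₂ (w , w∈Q , u→w) , v→u)))
      where
      v∉N⁻[Q] : ¬ InClosedIn D Q v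
      v∉N⁻[Q] (inj₁ v∈Q)  = v∉Q v∈Q
      v∉N⁻[Q] (inj₂ v→Q) = ¬v→Q v→Q

module Construction
  (D : Digraph) (sink-free : SinkFree D)
  (Q : Subset (Digraph.n D)) (Q-qk : QuasiKernel D Q)
  (R : Subset (Digraph.n D)) (R-spec : IsN⁻⁻ D Q R)
  (K : Subset (Digraph.n D)) (K-kernel : KernelOf D R K) where

  open Digraph D

  Q-indep : Independent D Q
  Q-indep = proj₁ Q-qk

  Q-reach : ∀ v → v ∉ Q → ReachesIn≤2 D Q v
  Q-reach = proj₂ Q-qk

  K⊆R : K ⊆ R
  K⊆R = proj₁ K-kernel

  K-indep : Independent D K
  K-indep = proj₁ (proj₂ K-kernel)

  K-absorbs : ∀ v → v ∈ R → v ∉ K → ArcInto D K v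
  K-absorbs = proj₂ (proj₂ K-kernel)

  -- Off N⁻(Q), ψ is the identity; only its values on N⁻(Q) matter.
  ψ : Fin n → Fin n
  ψ v with arcInto? D Q v
  ... | yes (w , _) = w
  ... | no  _       = v

  ψ-spec : ∀ {v} → ArcInto D Q v → ψ v ∈ Q × Arc v (ψ v)
  ψ-spec {v} v→Q with arcInto? D Q v
  ... | yes (_ , spec) = spec
  ... | no  ¬v→Q       = ⊥-elim (¬v→Q v→Q)

  A? : Decidable (λ v → v ∉ Q × ArcInto D Q v)
  A? v = ¬? (v ∈? Q) ×-dec arcInto? D Q v

  A : Subset n
  A = select A?

  Z : Subset n
  Z = image ψ A

  Z⊆Q : Z ⊆ Q
  Z⊆Q z∈Z with ∈-image⁻ ψ A z∈Z
  ... | v , v∈A , refl = proj₁ (ψ-spec (proj₂ (∈-select⁻ A? v∈A)))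

  ψ∈Z : ∀ {v} → v ∉ Q → ArcInto D Q v → ψ v ∈ Z
  ψ∈Z v∉Q v→Q = ∈-image⁺ ψ A (∈-select⁺ A? (v∉Q , v→Q))

  Z′? : Decidable (λ z → z ∈ Z × ¬ ArcInto D K z)
  Z′? z = z ∈? Z ×-dec ¬? (arcInto? D K z)

  Z′ : Subset n
  Z′ = select Z′?

  B? : Decidable (λ q → q ∈ Q × q ∉ Z × ¬ ArcInto D R q)
  B? q = q ∈? Q ×-dec ¬? (q ∈? Z) ×-dec ¬? (arcInto? D R q)

  B : Subset n
  B = select B?

  Y₁? : Decidable (λ q → q ∈ Q × q ∉ B)
  Y₁? q = q ∈? Q ×-dec ¬? (q ∈? B)

  Y₁ : Subset n
  Y₁ = select Y₁?

  Y₂ : Subset n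
  Y₂ = K ∪ Z′ ∪ B

  ψ∈Y₁ : ∀ {v} → v ∉ Q → ArcInto D Q v → ψ v ∈ Y₁
  ψ∈Y₁ {v} v∉Q v→Q = ∈-select⁺ Y₁? (Z⊆Q ψv∈Z , λ ψv∈B → proj₁ (proj₂ (∈-select⁻ B? ψv∈B)) ψv∈Z)
    where
    ψv∈Z : ψ v ∈ Z
    ψv∈Z = ψ∈Z v∉Q v→Q

  Y₁-indep : Independent D Y₁
  Y₁-indep x y x∈Y₁ y∈Y₁ = Q-indep x y (proj₁ (∈-select⁻ Y₁? x∈Y₁)) (proj₁ (∈-select⁻ Y₁? y∈Y₁))

  ∉Q⇒reachesY₁ : ∀ {v} → v ∉ Q → ReachesIn≤2 D Y₁ v
  ∉Q⇒reachesY₁ {v} v∉Q with Q-reach v v∉Q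
  ... | w , w∈Q , inj₁ v→w =
    ψ v , ψ∈Y₁ v∉Q v→Q , inj₁ (proj₂ (ψ-spec v→Q))
    where
    v→Q : ArcInto D Q v
    v→Q = w , w∈Q , v→w
  ... | w , w∈Q , inj₂ (u , v→u , u→w) =
    ψ u , ψ∈Y₁ u∉Q u→Q , inj₂ (u , v→u , proj₂ (ψ-spec u→Q))
    where
    u∉Q : u ∉ Q
    u∉Q u∈Q = Q-indep u w u∈Q w∈Q u→w
    u→Q : ArcInto D Q u
    u→Q = w , w∈Q , u→w

  ∈B⇒reachesY₁ : ∀ {q} → q ∈ B → ReachesIn≤2 D Y₁ q
  ∈B⇒reachesY₁ {q} q∈B = ψ w , ψ∈Y₁ w∉Q w→Q , inj₂ (w , q→w , proj₂ (ψ-spec w→Q))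
    where
    q∈Q : q ∈ Q
    q∈Q = proj₁ (∈-select⁻ B? q∈B)
    w : Fin n
    w = proj₁ (sink-free q)
    q→w : Arc q w
    q→w = proj₂ (sink-free q)
    w∉Q : w ∉ Q
    w∉Q w∈Q = Q-indep q w q∈Q w∈Q q→w
    w∉R : w ∉ R
    w∉R w∈R = proj₂ (proj₂ (∈-select⁻ B? q∈B)) (w , w∈R , q→w)
    w→Q : ArcInto D Q w
    w→Q = ∉N⁻⁻⇒ArcInto D R-spec Q-qk w∉Q w∉R

  Y₁-quasiKernel : QuasiKernel D Y₁
  Y₁-quasiKernel = Y₁-indep , reach
    where
    reach : ∀ v → v ∉ Y₁ → ReachesIn≤2 D Y₁ v
    reach v v∉Y₁ with v ∈? Q | v ∈? B
    ... | no  v∉Q | _       = ∉Q⇒reachesY₁ v∉Q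
    ... | yes _   | yes v∈B = ∈B⇒reachesY₁ v∈B
    ... | yes v∈Q | no  v∉B = ⊥-elim (v∉Y₁ (∈-select⁺ Y₁? (v∈Q , v∉B)))

  K∈Y₂ : ∀ {v} → v ∈ K → v ∈ Y₂
  K∈Y₂ = p⊆p∪q (Z′ ∪ B)

  Z′∈Y₂ : ∀ {v} → v ∈ Z′ → v ∈ Y₂
  Z′∈Y₂ = q⊆p∪q K (Z′ ∪ B) ∘ p⊆p∪q B

  B∈Y₂ : ∀ {v} → v ∈ B → v ∈ Y₂
  B∈Y₂ = q⊆p∪q K (Z′ ∪ B) ∘ q⊆p∪q Z′ B

  ∈Y₂⁻ : ∀ {v} → v ∈ Y₂ → v ∈ K ⊎ (v ∈ Q × ¬ ArcInto D K v)
  ∈Y₂⁻ v∈Y₂ with x∈p∪q⁻ K (Z′ ∪ B) v∈Y₂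
  ... | inj₁ v∈K = inj₁ v∈K
  ... | inj₂ v∈Z′∪B with x∈p∪q⁻ Z′ B v∈Z′∪B
  ...   | inj₁ v∈Z′ = let (v∈Z , ¬v→K) = ∈-select⁻ Z′? v∈Z′ in inj₂ (Z⊆Q v∈Z , ¬v→K)
  ...   | inj₂ v∈B  = let (v∈Q , _ , ¬v→R) = ∈-select⁻ B? v∈B in
                      inj₂ (v∈Q , λ (k , k∈K , v→k) → ¬v→R (k , K⊆R k∈K , v→k))

  Y₂-indep : Independent D Y₂
  Y₂-indep x y x∈Y₂ y∈Y₂ x→y with ∈Y₂⁻ x∈Y₂ | ∈Y₂⁻ y∈Y₂
  ... | inj₁ x∈K         | inj₁ y∈K       = K-indep x y x∈K y∈K x→y
  ... | inj₁ x∈K         | inj₂ (y∈Q , _) = ∈N⁻⁻⇒¬ArcInto D R-spec (K⊆R x∈K) (y , y∈Q , x→y)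
  ... | inj₂ (_ , ¬x→K)  | inj₁ y∈K       = ¬x→K (y , y∈K , x→y)
  ... | inj₂ (x∈Q , _)   | inj₂ (y∈Q , _) = Q-indep x y x∈Q y∈Q x→y

  ∈R⇒reachesY₂ : ∀ {v} → v ∈ R → v ∉ K → ReachesIn≤2 D Y₂ v
  ∈R⇒reachesY₂ {v} v∈R v∉K =
    let (k , k∈K , v→k) = K-absorbs v v∈R v∉K in k , K∈Y₂ k∈K , inj₁ v→k

  ∈N⁻⇒reachesY₂ : ∀ {v} → v ∉ Q → ArcInto D Q v → ReachesIn≤2 D Y₂ v
  ∈N⁻⇒reachesY₂ {v} v∉Q v→Q with arcInto? D K (ψ v)
  ... | yes (k , k∈K , ψv→k) = k , K∈Y₂ k∈K , inj₂ (ψ v , proj₂ (ψ-spec v→Q) , ψv→k)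
  ... | no  ¬ψv→K = ψ v , Z′∈Y₂ (∈-select⁺ Z′? (ψ∈Z v∉Q v→Q , ¬ψv→K)) , inj₁ (proj₂ (ψ-spec v→Q))

  ∈Q⇒reachesY₂ : ∀ {q} → q ∈ Q → q ∉ Y₂ → ReachesIn≤2 D Y₂ q
  ∈Q⇒reachesY₂ {q} q∈Q q∉Y₂ with arcInto? D K q | arcInto? D R q | q ∈? Z
  ... | yes (k , k∈K , q→k) | _ | _ = k , K∈Y₂ k∈K , inj₁ q→k
  ... | no ¬q→K | yes (w , w∈R , q→w) | _ =
    let (k , k∈K , w→k) = K-absorbs w w∈R (λ w∈K → ¬q→K (w , w∈K , q→w))
    in  k , K∈Y₂ k∈K , inj₂ (w , q→w , w→k)
  ... | no ¬q→K | no _    | yes q∈Z = ⊥-elim (q∉Y₂ (Z′∈Y₂ (∈-select⁺ Z′? (q∈Z , ¬q→K))))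
  ... | no _    | no ¬q→R | no  q∉Z = ⊥-elim (q∉Y₂ (B∈Y₂ (∈-select⁺ B? (q∈Q , q∉Z , ¬q→R))))

  Y₂-quasiKernel : QuasiKernel D Y₂
  Y₂-quasiKernel = Y₂-indep , reach
    where
    reach : ∀ v → v ∉ Y₂ → ReachesIn≤2 D Y₂ v
    reach v v∉Y₂ with v ∈? R | v ∈? Q
    ... | yes v∈R | _       = ∈R⇒reachesY₂ v∈R (v∉Y₂ ∘ K∈Y₂)
    ... | no  _   | yes v∈Q = ∈Q⇒reachesY₂ v∈Q v∉Y₂
    ... | no  v∉R | no  v∉Q = ∈N⁻⇒reachesY₂ v∉Q (∉N⁻⁻⇒ArcInto D R-spec Q-qk v∉Q v∉R)

  Y₁∪Y₂⊆Q∪K : Y₁ ∪ Y₂ ⊆ Q ∪ K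
  Y₁∪Y₂⊆Q∪K v∈ with x∈p∪q⁻ Y₁ Y₂ v∈
  ... | inj₁ v∈Y₁ = x∈p∪q⁺ (inj₁ (proj₁ (∈-select⁻ Y₁? v∈Y₁)))
  ... | inj₂ v∈Y₂ with ∈Y₂⁻ v∈Y₂
  ...   | inj₁ v∈K       = x∈p∪q⁺ (inj₂ v∈K)
  ...   | inj₂ (v∈Q , _) = x∈p∪q⁺ (inj₁ v∈Q)

  Y₁∩Y₂⊆Z : Y₁ ∩ Y₂ ⊆ Z
  Y₁∩Y₂⊆Z v∈ with x∈p∩q⁻ Y₁ Y₂ v∈
  ... | v∈Y₁ , v∈Y₂ with ∈-select⁻ Y₁? v∈Y₁ | x∈p∪q⁻ K (Z′ ∪ B) v∈Y₂
  ...   | v∈Q , _   | inj₁ v∈K     = ⊥-elim (∈N⁻⁻⇒∉Q D R-spec (K⊆R v∈K) v∈Q)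
  ...   | _   , v∉B | inj₂ v∈Z′∪B with x∈p∪q⁻ Z′ B v∈Z′∪B
  ...     | inj₁ v∈Z′ = proj₁ (∈-select⁻ Z′? v∈Z′)
  ...     | inj₂ v∈B  = ⊥-elim (v∉B v∈B)

  Empty[[Q∪K]∩A] : Empty ((Q ∪ K) ∩ A)
  Empty[[Q∪K]∩A] (v , v∈) with x∈p∩q⁻ (Q ∪ K) A v∈
  ... | v∈Q∪K , v∈A with ∈-select⁻ A? v∈A | x∈p∪q⁻ Q K v∈Q∪K
  ...   | v∉Q , _   | inj₁ v∈Q = v∉Q v∈Q
  ...   | _   , v→Q | inj₂ v∈K = ∈N⁻⁻⇒¬ArcInto D R-spec (K⊆R v∈K) v→Q

  ∣Y₁∣+∣Y₂∣≤n : ∣ Y₁ ∣ + ∣ Y₂ ∣ ≤ n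
  ∣Y₁∣+∣Y₂∣≤n = begin
    ∣ Y₁ ∣ + ∣ Y₂ ∣             ≡⟨ ∣p∪q∣+∣p∩q∣≡∣p∣+∣q∣ Y₁ Y₂ ⟨
    ∣ Y₁ ∪ Y₂ ∣ + ∣ Y₁ ∩ Y₂ ∣   ≤⟨ +-mono-≤ (p⊆q⇒∣p∣≤∣q∣ Y₁∪Y₂⊆Q∪K) (p⊆q⇒∣p∣≤∣q∣ Y₁∩Y₂⊆Z) ⟩
    ∣ Q ∪ K ∣ + ∣ Z ∣           ≤⟨ +-monoʳ-≤ ∣ Q ∪ K ∣ (∣image∣≤∣p∣ ψ A) ⟩
    ∣ Q ∪ K ∣ + ∣ A ∣           ≤⟨ Empty[p∩q]⇒∣p∣+∣q∣≤n (Q ∪ K) A Empty[[Q∪K]∩A] ⟩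
    n                           ∎
    where open ≤-Reasoning

lemma1 : (D : Digraph) → SinkFree D →
    (Q : Subset (Digraph.n D)) → QuasiKernel D Q →
    (R : Subset (Digraph.n D)) → IsN⁻⁻ D Q R →
    (∃[ K ] KernelOf D R K) →
    ∃[ Q′ ] (QuasiKernel D Q′ × 2 * ∣ Q′ ∣ ≤ Digraph.n D)
lemma1 D sink-free Q Q-qk R R-spec (K , K-kernel) =
  smaller-of-two Y₁-quasiKernel Y₂-quasiKernel ∣Y₁∣+∣Y₂∣≤n
  where open Construction D sink-free Q Q-qk R R-spec K K-kernel
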